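{- Let $N\geq 2$ be an integer and let $A\subsetneq\mathrm{SL}_2(\mathbb{Z}/N^2\mathbb{Z})$ be a proper subgroup whose reduction mod $N$ is all of $\mathrm{SL}_2(\mathbb{Z}/N\mathbb{Z})$. Then $A$ contains no element which is $\mathrm{GL}_2(\mathbb{Z}/N^2\mathbb{Z})$-conjugate to $u=\begin{pmatrix}1&1\\0&1\end{pmatrix}$. -}

module Defs where

open import Data.Nat using (ℕ; suc; _+_; _*_; _∸_; NonZero)
open import Data.Nat.DivMod using (_mod_)
open import Data.Fin using (Fin; toℕ)
open import Data.Product using (Σ; _×_; ∃)
open import Relation.Binary.PropositionalEquality using (_≡_)

-- ℤ/Mℤ is modelled by Fin M (canonical residues 0 … M-1), M ≠ 0.
module _ (M : ℕ) .{{_ : NonZero M}} where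

  _+ₘ_ : Fin M → Fin M → Fin M
  a +ₘ b = (toℕ a + toℕ b) mod M

  _*ₘ_ : Fin M → Fin M → Fin M
  a *ₘ b = (toℕ a * toℕ b) mod M

  -ₘ_ : Fin M → Fin M
  -ₘ a = (M ∸ toℕ a) mod M

  0ₘ 1ₘ : Fin M
  0ₘ = 0 mod M
  1ₘ = 1 mod M

  record Mat : Set where
    constructor mat
    field
      a b c d : Fin M
  open Mat public

  I : Mat
  I = mat 1ₘ 0ₘ 0ₘ 1ₘ

  u : Mat
  u = mat 1ₘ 1ₘ 0ₘ 1ₘ

  _·_ : Mat → Mat → Mat
  mat a₁ b₁ c₁ d₁ · mat a₂ b₂ c₂ d₂ =
    mat ((a₁ *ₘ a₂) +ₘ (b₁ *ₘ c₂)) ((a₁ *ₘ b₂) +ₘ (b₁ *ₘ d₂))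
        ((c₁ *ₘ a₂) +ₘ (d₁ *ₘ c₂)) ((c₁ *ₘ b₂) +ₘ (d₁ *ₘ d₂))

  det : Mat → Fin M
  det (mat a b c d) = (a *ₘ d) +ₘ (-ₘ (b *ₘ c))

  -- adjugate; for x ∈ SL₂ this is the inverse of x
  adj : Mat → Mat
  adj (mat a b c d) = mat d (-ₘ b) (-ₘ c) a

  IsSL : Mat → Set
  IsSL x = det x ≡ 1ₘ

  IsGL : Mat → Set
  IsGL g = Σ Mat λ h → (g · h ≡ I) × (h · g ≡ I)

  GLConj : Mat → Mat → Set
  GLConj x y = Σ Mat λ g → Σ Mat λ h → (g · h ≡ I) × (h · g ≡ I) × (x ≡ (g · y) · h)

  record IsSubgroupSL (A : Mat → Set) : Set where
    field
      ⊆SL    : ∀ x → A x → IsSL x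
      has-I  : A I
      ·-closed : ∀ x y → A x → A y → A (x · y)
      inv-closed : ∀ x → A x → A (adj x)

  ProperSL : (Mat → Set) → Set
  ProperSL A = Σ Mat λ x → IsSL x × (A x → Data.Empty.⊥)
    where import Data.Empty

red : (N : ℕ) .{{_ : NonZero N}} .{{_ : NonZero (N * N)}} → Mat (N * N) → Mat N
red N (mat a b c d) = mat (toℕ a mod N) (toℕ b mod N) (toℕ c mod N) (toℕ d mod N)

ReductionSurjSL : (N : ℕ) .{{_ : NonZero N}} .{{_ : NonZero (N * N)}} → (Mat (N * N) → Set) → Set
ReductionSurjSL N A = ∀ (y : Mat N) → IsSL N y → Σ (Mat (N * N)) λ x → A x × (red N x ≡ y)

-- Call Lie the set of integer matrices Y such that some element of A is congruent to 𝕀 + N Y modulo N².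
-- As (𝕀 + N Y)(𝕀 + N Z) ≡ 𝕀 + N (Y + Z) modulo N², Lie is an additive group, and as A surjects onto
-- SL₂(ℤ/N), Lie is stable under conjugation by integer matrices of determinant 1 modulo N.  If A contains
-- x = g u g⁻¹ = 𝕀 + V, then V = g E₁₂ g⁻¹ squares to 0, so x^N = 𝕀 + N V and V ∈ Lie; rescaling g to
-- determinant 1 modulo N and conjugating back gives E₁₂ ∈ Lie, and conjugates of E₁₂ span all traceless
-- matrices.  As det (𝕀 + N Y) ≡ 1 + N tr Y modulo N², every element of the kernel of reduction modulo N
-- is 𝕀 + N Y with Y traceless, so A contains this kernel; with surjectivity this forces A = SL₂(ℤ/N²).

module Submission where

open import Defs
open import Data.Empty using (⊥-elim)
open import Data.Fin using (Fin; toℕ)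
open import Data.Fin.Properties using (toℕ-fromℕ<; toℕ-injective; toℕ<n)
open import Data.Integer as ℤ using (ℤ; +_; -[1+_]; +[1+_]; _+_; _*_; -_; _-_; 0ℤ; 1ℤ)
open import Data.Integer.DivMod using (a≡a%ℕn+[a/ℕn]*n)
import Data.Integer.Properties as ℤ
open import Data.Integer.Tactic.RingSolver using (solve-∀)
open import Data.Nat as ℕ using (ℕ; zero; suc; NonZero; _≤_)
import Data.Nat.DivMod as DivMod
import Data.Nat.Properties as ℕ
open import Data.Product using (Σ; _×_; _,_; proj₁; proj₂)
open import Level using (0ℓ)
open import Algebra.Bundles using (Monoid)
import Algebra.Solver.Monoid as MonoidSolver
open import Relation.Binary.Bundles using (Setoid)
open import Relation.Binary.PropositionalEquality
import Relation.Binary.Reasoning.Setoid as SetoidReasoning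
open import Relation.Nullary using (¬_)

-- Congruences of integers

infix 4 _≡_mod_
record _≡_mod_ (x y m : ℤ) : Set where
  constructor by
  field
    quotient : ℤ
    equation : x ≡ y + quotient * m
open _≡_mod_

module _ {m : ℤ} where

  mod-refl : ∀ {x} → x ≡ x mod m
  mod-refl {x} = by 0ℤ (identity x m)
    where
    identity : ∀ x m → x ≡ x + 0ℤ * m
    identity = solve-∀

  ≡⇒mod : ∀ {x y} → x ≡ y → x ≡ y mod m
  ≡⇒mod refl = mod-refl

  mod-sym : ∀ {x y} → x ≡ y mod m → y ≡ x mod m
  mod-sym {y = y} (by k eq) = by (- k) (trans (identity y k m) (cong (λ z → z + - k * m) (sym eq)))
    where
    identity : ∀ y k m → y ≡ y + k * m + - k * m
    identity = solve-∀

  mod-trans : ∀ {x y z} → x ≡ y mod m → y ≡ z mod m → x ≡ z mod m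
  mod-trans {z = z} (by k refl) (by l refl) = by (k + l) (identity z k l m)
    where
    identity : ∀ z k l m → z + l * m + k * m ≡ z + (k + l) * m
    identity = solve-∀

  +-cong-mod : ∀ {x x′ y y′} → x ≡ x′ mod m → y ≡ y′ mod m → x + y ≡ x′ + y′ mod m
  +-cong-mod {x′ = x} {y′ = y} (by k refl) (by l refl) = by (k + l) (identity x y k l m)
    where
    identity : ∀ x y k l m → x + k * m + (y + l * m) ≡ x + y + (k + l) * m
    identity = solve-∀

  *-cong-mod : ∀ {x x′ y y′} → x ≡ x′ mod m → y ≡ y′ mod m → x * y ≡ x′ * y′ mod m
  *-cong-mod {x′ = x} {y′ = y} (by k refl) (by l refl) = by (k * y + x * l + k * l * m) (identity x y k l m)
    where
    identity : ∀ x y k l m → (x + k * m) * (y + l * m) ≡ x * y + (k * y + x * l + k * l * m) * m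
    identity = solve-∀

  neg-cong-mod : ∀ {x x′} → x ≡ x′ mod m → - x ≡ - x′ mod m
  neg-cong-mod {x′ = x} (by k refl) = by (- k) (identity x k m)
    where
    identity : ∀ x k m → - (x + k * m) ≡ - x + - k * m
    identity = solve-∀

mod-setoid : ℤ → Setoid 0ℓ 0ℓ
mod-setoid m = record
  { Carrier = ℤ
  ; _≈_ = λ x y → x ≡ y mod m
  ; isEquivalence = record { refl = mod-refl ; sym = mod-sym ; trans = mod-trans }
  }

mod-scale : ∀ {m x y} n → x ≡ y mod m → n * x ≡ n * y mod n * m
mod-scale {m} {y = y} n (by k refl) = by k (identity n y k m)
  where
  identity : ∀ n y k m → n * (y + k * m) ≡ n * y + k * (n * m)
  identity = solve-∀

mod-weaken : ∀ {m x y} n → x ≡ y mod n * m → x ≡ y mod m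
mod-weaken {m} {y = y} n (by k refl) = by (k * n) (identity y k n m)
  where
  identity : ∀ y k n m → y + k * (n * m) ≡ y + k * n * m
  identity = solve-∀

mod-cancel : ∀ {t} n .{{_ : ℤ.NonZero n}} → n * t ≡ 0ℤ mod n * n → t ≡ 0ℤ mod n
mod-cancel {t} n (by k eq) = by k (ℤ.*-cancelˡ-≡ n t (0ℤ + k * n) (trans eq (identity k n)))
  where
  identity : ∀ k n → 0ℤ + k * (n * n) ≡ n * (0ℤ + k * n)
  identity = solve-∀

-- Integer 2 × 2 matrices

-- A data type rather than a record: without η, a stuck product X ⊗ Y unifies with another product
-- argumentwise, so the matrices in congruence lemmas such as ⊗-cong below are inferred.
data ℤMat : Set where
  [_,_∣_,_] : ℤ → ℤ → ℤ → ℤ → ℤMat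

m₁₁ m₂₁ m₂₂ : ℤMat → ℤ
m₁₁ [ a , _ ∣ _ , _ ] = a
m₂₁ [ _ , _ ∣ c , _ ] = c
m₂₂ [ _ , _ ∣ _ , d ] = d

infixl 6 _⊕_
infixl 7 _⊗_
infixr 8 _•_

_⊕_ : ℤMat → ℤMat → ℤMat
[ a , b ∣ c , d ] ⊕ [ p , q ∣ r , s ] = [ a + p , b + q ∣ c + r , d + s ]

_⊗_ : ℤMat → ℤMat → ℤMat
[ a , b ∣ c , d ] ⊗ [ p , q ∣ r , s ] = [ a * p + b * r , a * q + b * s ∣ c * p + d * r , c * q + d * s ]

_•_ : ℤ → ℤMat → ℤMat
k • [ a , b ∣ c , d ] = [ k * a , k * b ∣ k * c , k * d ]

adjℤ : ℤMat → ℤMat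
adjℤ [ a , b ∣ c , d ] = [ d , - b ∣ - c , a ]

detℤ : ℤMat → ℤ
detℤ [ a , b ∣ c , d ] = a * d - b * c

trℤ : ℤMat → ℤ
trℤ [ a , b ∣ c , d ] = a + d

𝕀 𝕆 E₁₂ E₂₁ : ℤMat
𝕀 = [ 1ℤ , 0ℤ ∣ 0ℤ , 1ℤ ]
𝕆 = [ 0ℤ , 0ℤ ∣ 0ℤ , 0ℤ ]
E₁₂ = [ 0ℤ , 1ℤ ∣ 0ℤ , 0ℤ ]
E₂₁ = [ 0ℤ , 0ℤ ∣ 1ℤ , 0ℤ ]

entrywise : ∀ {a b c d p q r s} → a ≡ p → b ≡ q → c ≡ r → d ≡ s → [ a , b ∣ c , d ] ≡ [ p , q ∣ r , s ]
entrywise refl refl refl refl = refl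

⊕-assoc : ∀ X Y Z → X ⊕ Y ⊕ Z ≡ X ⊕ (Y ⊕ Z)
⊕-assoc [ a , b ∣ c , d ] [ p , q ∣ r , s ] [ e , f ∣ g , h ] =
  entrywise (ℤ.+-assoc a p e) (ℤ.+-assoc b q f) (ℤ.+-assoc c r g) (ℤ.+-assoc d s h)

⊕-comm : ∀ X Y → X ⊕ Y ≡ Y ⊕ X
⊕-comm [ a , b ∣ c , d ] [ p , q ∣ r , s ] =
  entrywise (ℤ.+-comm a p) (ℤ.+-comm b q) (ℤ.+-comm c r) (ℤ.+-comm d s)

⊕-identityʳ : ∀ X → X ⊕ 𝕆 ≡ X
⊕-identityʳ [ a , b ∣ c , d ] =
  entrywise (ℤ.+-identityʳ a) (ℤ.+-identityʳ b) (ℤ.+-identityʳ c) (ℤ.+-identityʳ d)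

•-distribʳ-+ : ∀ k l X → (k + l) • X ≡ k • X ⊕ l • X
•-distribʳ-+ k l [ a , b ∣ c , d ] =
  entrywise (ℤ.*-distribʳ-+ a k l) (ℤ.*-distribʳ-+ b k l) (ℤ.*-distribʳ-+ c k l) (ℤ.*-distribʳ-+ d k l)

•-distribˡ-⊕ : ∀ k X Y → k • (X ⊕ Y) ≡ k • X ⊕ k • Y
•-distribˡ-⊕ k [ a , b ∣ c , d ] [ p , q ∣ r , s ] =
  entrywise (ℤ.*-distribˡ-+ k a p) (ℤ.*-distribˡ-+ k b q) (ℤ.*-distribˡ-+ k c r) (ℤ.*-distribˡ-+ k d s)

•-assoc : ∀ k l X → (k * l) • X ≡ k • l • X
•-assoc k l [ a , b ∣ c , d ] = entrywise (ℤ.*-assoc k l a) (ℤ.*-assoc k l b) (ℤ.*-assoc k l c) (ℤ.*-assoc k l d)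

•-identityˡ : ∀ X → 1ℤ • X ≡ X
•-identityˡ [ a , b ∣ c , d ] =
  entrywise (ℤ.*-identityˡ a) (ℤ.*-identityˡ b) (ℤ.*-identityˡ c) (ℤ.*-identityˡ d)

•-zeroˡ : ∀ X → 0ℤ • X ≡ 𝕆
•-zeroˡ [ a , b ∣ c , d ] = refl

•-zeroʳ : ∀ k → k • 𝕆 ≡ 𝕆
•-zeroʳ k = entrywise (ℤ.*-zeroʳ k) (ℤ.*-zeroʳ k) (ℤ.*-zeroʳ k) (ℤ.*-zeroʳ k)

•-suc : ∀ k X → (1ℤ + k) • X ≡ X ⊕ k • X
•-suc k X = trans (•-distribʳ-+ 1ℤ k X) (cong (_⊕ k • X) (•-identityˡ X))

⊗-assoc : ∀ X Y Z → X ⊗ Y ⊗ Z ≡ X ⊗ (Y ⊗ Z)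
⊗-assoc [ a , b ∣ c , d ] [ p , q ∣ r , s ] [ e , f ∣ g , h ] =
  entrywise (entry a b p q r s e g) (entry a b p q r s f h) (entry c d p q r s e g) (entry c d p q r s f h)
  where
  entry : ∀ x y p q r s z w → (x * p + y * r) * z + (x * q + y * s) * w ≡ x * (p * z + q * w) + y * (r * z + s * w)
  entry = solve-∀

⊗-distribˡ-⊕ : ∀ X Y Z → X ⊗ (Y ⊕ Z) ≡ X ⊗ Y ⊕ X ⊗ Z
⊗-distribˡ-⊕ [ a , b ∣ c , d ] [ p , q ∣ r , s ] [ e , f ∣ g , h ] =
  entrywise (entry a b p r e g) (entry a b q s f h) (entry c d p r e g) (entry c d q s f h)
  where
  entry : ∀ x y p r e g → x * (p + e) + y * (r + g) ≡ x * p + y * r + (x * e + y * g)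
  entry = solve-∀

⊗-distribʳ-⊕ : ∀ X Y Z → (X ⊕ Y) ⊗ Z ≡ X ⊗ Z ⊕ Y ⊗ Z
⊗-distribʳ-⊕ [ a , b ∣ c , d ] [ p , q ∣ r , s ] [ e , f ∣ g , h ] =
  entrywise (entry a b p q e g) (entry a b p q f h) (entry c d r s e g) (entry c d r s f h)
  where
  entry : ∀ x y p q e g → (x + p) * e + (y + q) * g ≡ x * e + y * g + (p * e + q * g)
  entry = solve-∀

⊗-identityˡ : ∀ X → 𝕀 ⊗ X ≡ X
⊗-identityˡ [ a , b ∣ c , d ] = entrywise (first a c) (first b d) (second a c) (second b d)
  where
  first : ∀ x y → 1ℤ * x + 0ℤ * y ≡ x
  first = solve-∀
  second : ∀ x y → 0ℤ * x + 1ℤ * y ≡ y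
  second = solve-∀

⊗-identityʳ : ∀ X → X ⊗ 𝕀 ≡ X
⊗-identityʳ [ a , b ∣ c , d ] = entrywise (first a b) (second a b) (first c d) (second c d)
  where
  first : ∀ x y → x * 1ℤ + y * 0ℤ ≡ x
  first = solve-∀
  second : ∀ x y → x * 0ℤ + y * 1ℤ ≡ y
  second = solve-∀

⊗-zeroˡ : ∀ X → 𝕆 ⊗ X ≡ 𝕆
⊗-zeroˡ [ a , b ∣ c , d ] = refl

⊗-zeroʳ : ∀ X → X ⊗ 𝕆 ≡ 𝕆
⊗-zeroʳ [ a , b ∣ c , d ] = entrywise (vanish a b) (vanish a b) (vanish c d) (vanish c d)
  where
  vanish : ∀ x y → x * 0ℤ + y * 0ℤ ≡ 0ℤ
  vanish = solve-∀

⊗-•ˡ : ∀ k X Y → k • X ⊗ Y ≡ k • (X ⊗ Y)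
⊗-•ˡ k [ a , b ∣ c , d ] [ p , q ∣ r , s ] =
  entrywise (entry k a b p r) (entry k a b q s) (entry k c d p r) (entry k c d q s)
  where
  entry : ∀ k x y z w → k * x * z + k * y * w ≡ k * (x * z + y * w)
  entry = solve-∀

⊗-•ʳ : ∀ k X Y → X ⊗ k • Y ≡ k • (X ⊗ Y)
⊗-•ʳ k [ a , b ∣ c , d ] [ p , q ∣ r , s ] =
  entrywise (entry k a b p r) (entry k a b q s) (entry k c d p r) (entry k c d q s)
  where
  entry : ∀ k x y z w → x * (k * z) + y * (k * w) ≡ k * (x * z + y * w)
  entry = solve-∀

adj-inverseˡ : ∀ X → adjℤ X ⊗ X ≡ detℤ X • 𝕀
adj-inverseˡ [ a , b ∣ c , d ] = entrywise (e₁₁ a b c d) (e₁₂ a b c d) (e₂₁ a b c d) (e₂₂ a b c d)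
  where
  e₁₁ : ∀ a b c d → d * a + - b * c ≡ (a * d - b * c) * 1ℤ
  e₁₁ = solve-∀
  e₁₂ : ∀ a b c d → d * b + - b * d ≡ (a * d - b * c) * 0ℤ
  e₁₂ = solve-∀
  e₂₁ : ∀ a b c d → - c * a + a * c ≡ (a * d - b * c) * 0ℤ
  e₂₁ = solve-∀
  e₂₂ : ∀ a b c d → - c * b + a * d ≡ (a * d - b * c) * 1ℤ
  e₂₂ = solve-∀

•-⊗-• : ∀ k l X Y → k • X ⊗ l • Y ≡ (k * l) • (X ⊗ Y)
•-⊗-• k l X Y = begin
  k • X ⊗ l • Y        ≡⟨ ⊗-•ˡ k X (l • Y) ⟩
  k • (X ⊗ l • Y)      ≡⟨ cong (k •_) (⊗-•ʳ l X Y) ⟩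
  k • l • (X ⊗ Y)      ≡⟨ •-assoc k l (X ⊗ Y) ⟨
  (k * l) • (X ⊗ Y)    ∎
  where open ≡-Reasoning

adj-inverseʳ : ∀ X → X ⊗ adjℤ X ≡ detℤ X • 𝕀
adj-inverseʳ [ a , b ∣ c , d ] = entrywise (e₁₁ a b c d) (e₁₂ a b c d) (e₂₁ a b c d) (e₂₂ a b c d)
  where
  e₁₁ : ∀ a b c d → a * d + b * - c ≡ (a * d - b * c) * 1ℤ
  e₁₁ = solve-∀
  e₁₂ : ∀ a b c d → a * - b + b * a ≡ (a * d - b * c) * 0ℤ
  e₁₂ = solve-∀
  e₂₁ : ∀ a b c d → c * d + d * - c ≡ (a * d - b * c) * 0ℤ
  e₂₁ = solve-∀
  e₂₂ : ∀ a b c d → c * - b + d * a ≡ (a * d - b * c) * 1ℤ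
  e₂₂ = solve-∀

adj-anti-⊗ : ∀ X Y → adjℤ (X ⊗ Y) ≡ adjℤ Y ⊗ adjℤ X
adj-anti-⊗ [ a , b ∣ c , d ] [ p , q ∣ r , s ] =
  entrywise (e₁₁ c d q s) (e₁₂ a b q s) (e₂₁ c d p r) (e₂₂ a b p r)
  where
  e₁₁ : ∀ c d q s → c * q + d * s ≡ s * d + - q * - c
  e₁₁ = solve-∀
  e₁₂ : ∀ a b q s → - (a * q + b * s) ≡ s * - b + - q * a
  e₁₂ = solve-∀
  e₂₁ : ∀ c d p r → - (c * p + d * r) ≡ - r * d + p * - c
  e₂₁ = solve-∀
  e₂₂ : ∀ a b p r → a * p + b * r ≡ - r * - b + p * a
  e₂₂ = solve-∀

⊗-E₁₂-⊗ : ∀ P Q → P ⊗ E₁₂ ⊗ Q ≡ [ m₁₁ P * m₂₁ Q , m₁₁ P * m₂₂ Q ∣ m₂₁ P * m₂₁ Q , m₂₁ P * m₂₂ Q ]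
⊗-E₁₂-⊗ [ a , b ∣ c , d ] [ p , q ∣ r , s ] =
  entrywise (entry a b p r) (entry a b q s) (entry c d p r) (entry c d q s)
  where
  entry : ∀ x y z w → (x * 0ℤ + y * 0ℤ) * z + (x * 1ℤ + y * 0ℤ) * w ≡ x * w
  entry = solve-∀

det-⊗ : ∀ X Y → detℤ (X ⊗ Y) ≡ detℤ X * detℤ Y
det-⊗ [ a , b ∣ c , d ] [ p , q ∣ r , s ] = identity a b c d p q r s
  where
  identity : ∀ a b c d p q r s →
             (a * p + b * r) * (c * q + d * s) - (a * q + b * s) * (c * p + d * r) ≡ (a * d - b * c) * (p * s - q * r)
  identity = solve-∀

det-adj : ∀ X → detℤ (adjℤ X) ≡ detℤ X
det-adj [ a , b ∣ c , d ] = identity a b c d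
  where
  identity : ∀ a b c d → d * a - - b * - c ≡ a * d - b * c
  identity = solve-∀

det-𝕀⊕• : ∀ n X → detℤ (𝕀 ⊕ n • X) ≡ 1ℤ + n * trℤ X + n * n * detℤ X
det-𝕀⊕• n [ a , b ∣ c , d ] = identity n a b c d
  where
  identity : ∀ n a b c d →
             (1ℤ + n * a) * (1ℤ + n * d) - (0ℤ + n * b) * (0ℤ + n * c) ≡ 1ℤ + n * (a + d) + n * n * (a * d - b * c)
  identity = solve-∀

⊗-monoid : Monoid 0ℓ 0ℓ
⊗-monoid = record
  { isMonoid = record
    { isSemigroup = record
      { isMagma = record { isEquivalence = isEquivalence ; ∙-cong = cong₂ _⊗_ }
      ; assoc = ⊗-assoc
      }
    ; identity = ⊗-identityˡ , ⊗-identityʳ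
    }
  }

open MonoidSolver ⊗-monoid using (solve; _⊜_; id) renaming (_⊕_ to _⊙_)

⊗-𝕀⊕-⊗ : ∀ P Y Q → P ⊗ (𝕀 ⊕ Y) ⊗ Q ≡ P ⊗ Q ⊕ P ⊗ Y ⊗ Q
⊗-𝕀⊕-⊗ P Y Q = begin
  P ⊗ (𝕀 ⊕ Y) ⊗ Q           ≡⟨ cong (_⊗ Q) (⊗-distribˡ-⊕ P 𝕀 Y) ⟩
  (P ⊗ 𝕀 ⊕ P ⊗ Y) ⊗ Q       ≡⟨ ⊗-distribʳ-⊕ (P ⊗ 𝕀) (P ⊗ Y) Q ⟩
  P ⊗ 𝕀 ⊗ Q ⊕ P ⊗ Y ⊗ Q     ≡⟨ cong (λ R → R ⊗ Q ⊕ P ⊗ Y ⊗ Q) (⊗-identityʳ P) ⟩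
  P ⊗ Q ⊕ P ⊗ Y ⊗ Q         ∎
  where open ≡-Reasoning

𝕀⊕-⊗-𝕀⊕ : ∀ X Y → (𝕀 ⊕ X) ⊗ (𝕀 ⊕ Y) ≡ 𝕀 ⊕ (X ⊕ Y) ⊕ X ⊗ Y
𝕀⊕-⊗-𝕀⊕ X Y = begin
  (𝕀 ⊕ X) ⊗ (𝕀 ⊕ Y)               ≡⟨ ⊗-distribʳ-⊕ 𝕀 X (𝕀 ⊕ Y) ⟩
  𝕀 ⊗ (𝕀 ⊕ Y) ⊕ X ⊗ (𝕀 ⊕ Y)       ≡⟨ cong₂ _⊕_ (⊗-identityˡ (𝕀 ⊕ Y)) (⊗-distribˡ-⊕ X 𝕀 Y) ⟩
  𝕀 ⊕ Y ⊕ (X ⊗ 𝕀 ⊕ X ⊗ Y)         ≡⟨ cong (λ Z → 𝕀 ⊕ Y ⊕ (Z ⊕ X ⊗ Y)) (⊗-identityʳ X) ⟩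
  𝕀 ⊕ Y ⊕ (X ⊕ X ⊗ Y)             ≡⟨ ⊕-assoc (𝕀 ⊕ Y) X (X ⊗ Y) ⟨
  𝕀 ⊕ Y ⊕ X ⊕ X ⊗ Y               ≡⟨ cong (_⊕ X ⊗ Y) (⊕-assoc 𝕀 Y X) ⟩
  𝕀 ⊕ (Y ⊕ X) ⊕ X ⊗ Y             ≡⟨ cong (λ Z → 𝕀 ⊕ Z ⊕ X ⊗ Y) (⊕-comm Y X) ⟩
  𝕀 ⊕ (X ⊕ Y) ⊕ X ⊗ Y             ∎
  where open ≡-Reasoning

⊗-adj-⊗ : ∀ X W → X ⊗ adjℤ W ⊗ W ≡ detℤ W • X
⊗-adj-⊗ X W = begin
  X ⊗ adjℤ W ⊗ W         ≡⟨ ⊗-assoc X (adjℤ W) W ⟩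
  X ⊗ (adjℤ W ⊗ W)       ≡⟨ cong (X ⊗_) (adj-inverseˡ W) ⟩
  X ⊗ detℤ W • 𝕀         ≡⟨ ⊗-•ʳ (detℤ W) X 𝕀 ⟩
  detℤ W • (X ⊗ 𝕀)       ≡⟨ cong (detℤ W •_) (⊗-identityʳ X) ⟩
  detℤ W • X             ∎
  where open ≡-Reasoning

trace-vanishes : ∀ n .{{_ : ℤ.NonZero n}} X → detℤ (𝕀 ⊕ n • X) ≡ 1ℤ mod n * n → trℤ X ≡ 0ℤ mod n
trace-vanishes n X (by k eq) = mod-cancel n (by (k - detℤ X) (begin
  n * trℤ X                                              ≡⟨ isolate n (trℤ X) (detℤ X) ⟩
  1ℤ + n * trℤ X + n * n * detℤ X - 1ℤ - n * n * detℤ X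
    ≡⟨ cong (λ w → w - 1ℤ - n * n * detℤ X) (trans (sym (det-𝕀⊕• n X)) eq) ⟩
  1ℤ + k * (n * n) - 1ℤ - n * n * detℤ X                 ≡⟨ collect n k (detℤ X) ⟩
  0ℤ + (k - detℤ X) * (n * n)                            ∎))
  where
  open ≡-Reasoning
  isolate : ∀ n t d → n * t ≡ 1ℤ + n * t + n * n * d - 1ℤ - n * n * d
  isolate = solve-∀
  collect : ∀ n k d → 1ℤ + k * (n * n) - 1ℤ - n * n * d ≡ 0ℤ + (k - d) * (n * n)
  collect = solve-∀

-- Congruences of integer matrices

infix 4 _≋_mod_
data _≋_mod_ : ℤMat → ℤMat → ℤ → Set where
  entries : ∀ {a b c d p q r s m} → a ≡ p mod m → b ≡ q mod m → c ≡ r mod m → d ≡ s mod m →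
            [ a , b ∣ c , d ] ≋ [ p , q ∣ r , s ] mod m

module _ {m : ℤ} where

  ≋-refl : ∀ {X} → X ≋ X mod m
  ≋-refl {[ _ , _ ∣ _ , _ ]} = entries mod-refl mod-refl mod-refl mod-refl

  ≡⇒≋ : ∀ {X Y} → X ≡ Y → X ≋ Y mod m
  ≡⇒≋ refl = ≋-refl

  ≋-sym : ∀ {X Y} → X ≋ Y mod m → Y ≋ X mod m
  ≋-sym (entries e₁₁ e₁₂ e₂₁ e₂₂) = entries (mod-sym e₁₁) (mod-sym e₁₂) (mod-sym e₂₁) (mod-sym e₂₂)

  ≋-trans : ∀ {X Y Z} → X ≋ Y mod m → Y ≋ Z mod m → X ≋ Z mod m
  ≋-trans (entries e₁₁ e₁₂ e₂₁ e₂₂) (entries f₁₁ f₁₂ f₂₁ f₂₂) =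
    entries (mod-trans e₁₁ f₁₁) (mod-trans e₁₂ f₁₂) (mod-trans e₂₁ f₂₁) (mod-trans e₂₂ f₂₂)

  ⊕-cong : ∀ {X X′ Y Y′} → X ≋ X′ mod m → Y ≋ Y′ mod m → X ⊕ Y ≋ X′ ⊕ Y′ mod m
  ⊕-cong (entries e₁₁ e₁₂ e₂₁ e₂₂) (entries f₁₁ f₁₂ f₂₁ f₂₂) =
    entries (+-cong-mod e₁₁ f₁₁) (+-cong-mod e₁₂ f₁₂) (+-cong-mod e₂₁ f₂₁) (+-cong-mod e₂₂ f₂₂)

  ⊗-cong : ∀ {X X′ Y Y′} → X ≋ X′ mod m → Y ≋ Y′ mod m → X ⊗ Y ≋ X′ ⊗ Y′ mod m
  ⊗-cong (entries e₁₁ e₁₂ e₂₁ e₂₂) (entries f₁₁ f₁₂ f₂₁ f₂₂) = entries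
    (+-cong-mod (*-cong-mod e₁₁ f₁₁) (*-cong-mod e₁₂ f₂₁)) (+-cong-mod (*-cong-mod e₁₁ f₁₂) (*-cong-mod e₁₂ f₂₂))
    (+-cong-mod (*-cong-mod e₂₁ f₁₁) (*-cong-mod e₂₂ f₂₁)) (+-cong-mod (*-cong-mod e₂₁ f₁₂) (*-cong-mod e₂₂ f₂₂))

  •-cong : ∀ {k k′ X X′} → k ≡ k′ mod m → X ≋ X′ mod m → k • X ≋ k′ • X′ mod m
  •-cong e (entries f₁₁ f₁₂ f₂₁ f₂₂) =
    entries (*-cong-mod e f₁₁) (*-cong-mod e f₁₂) (*-cong-mod e f₂₁) (*-cong-mod e f₂₂)

  adj-cong : ∀ {X X′} → X ≋ X′ mod m → adjℤ X ≋ adjℤ X′ mod m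
  adj-cong (entries e₁₁ e₁₂ e₂₁ e₂₂) = entries e₂₂ (neg-cong-mod e₁₂) (neg-cong-mod e₂₁) e₁₁

  det-cong : ∀ {X X′} → X ≋ X′ mod m → detℤ X ≡ detℤ X′ mod m
  det-cong (entries e₁₁ e₁₂ e₂₁ e₂₂) = +-cong-mod (*-cong-mod e₁₁ e₂₂) (neg-cong-mod (*-cong-mod e₁₂ e₂₁))

≋-setoid : ℤ → Setoid 0ℓ 0ℓ
≋-setoid m = record
  { Carrier = ℤMat
  ; _≈_ = λ X Y → X ≋ Y mod m
  ; isEquivalence = record { refl = ≋-refl ; sym = ≋-sym ; trans = ≋-trans }
  }

≋-scale : ∀ {m X Y} n → X ≋ Y mod m → n • X ≋ n • Y mod n * m
≋-scale n (entries e₁₁ e₁₂ e₂₁ e₂₂) = entries (mod-scale n e₁₁) (mod-scale n e₁₂) (mod-scale n e₂₁) (mod-scale n e₂₂)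

≋-weaken : ∀ {m X Y} n → X ≋ Y mod n * m → X ≋ Y mod m
≋-weaken n (entries e₁₁ e₁₂ e₂₁ e₂₂) = entries (mod-weaken n e₁₁) (mod-weaken n e₁₂) (mod-weaken n e₂₁) (mod-weaken n e₂₂)

⊕-multiple : ∀ m X W → X ⊕ m • W ≋ X mod m
⊕-multiple m [ a , b ∣ c , d ] [ p , q ∣ r , s ] =
  entries (multiple a p) (multiple b q) (multiple c r) (multiple d s)
  where
  multiple : ∀ x k → x + m * k ≡ x mod m
  multiple x k = by k (cong (_+_ x) (ℤ.*-comm m k))

≋𝕀⇒𝕀⊕ : ∀ {n K} → K ≋ 𝕀 mod n → Σ ℤMat λ X → K ≡ 𝕀 ⊕ n • X
≋𝕀⇒𝕀⊕ {n} (entries (by k₁₁ e₁₁) (by k₁₂ e₁₂) (by k₂₁ e₂₁) (by k₂₂ e₂₂)) =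
  [ k₁₁ , k₁₂ ∣ k₂₁ , k₂₂ ] ,
  entrywise (commute 1ℤ k₁₁ e₁₁) (commute 0ℤ k₁₂ e₁₂) (commute 0ℤ k₂₁ e₂₁) (commute 1ℤ k₂₂ e₂₂)
  where
  commute : ∀ {x} y k → x ≡ y + k * n → x ≡ y + n * k
  commute y k e = trans e (cong (_+_ y) (ℤ.*-comm k n))

det-inverse : ∀ {m} G H → G ⊗ H ≋ 𝕀 mod m → detℤ G * detℤ H ≡ 1ℤ mod m
det-inverse G H GH≋𝕀 = mod-trans (≡⇒mod (sym (det-⊗ G H))) (det-cong GH≋𝕀)

unipotent-square : ∀ {m} G H → H ⊗ G ≋ 𝕀 mod m → G ⊗ E₁₂ ⊗ H ⊗ (G ⊗ E₁₂ ⊗ H) ≋ 𝕆 mod m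
unipotent-square {m} G H HG≋𝕀 = begin
  G ⊗ E₁₂ ⊗ H ⊗ (G ⊗ E₁₂ ⊗ H)      ≡⟨ regroup G E₁₂ H ⟩
  G ⊗ E₁₂ ⊗ (H ⊗ G) ⊗ (E₁₂ ⊗ H)    ≈⟨ ⊗-cong (⊗-cong ≋-refl HG≋𝕀) ≋-refl ⟩
  G ⊗ E₁₂ ⊗ 𝕀 ⊗ (E₁₂ ⊗ H)          ≡⟨ collapse G E₁₂ H ⟩
  G ⊗ (E₁₂ ⊗ E₁₂) ⊗ H              ≡⟨ cong (_⊗ H) (⊗-zeroʳ G) ⟩
  𝕆 ⊗ H                            ≡⟨ ⊗-zeroˡ H ⟩
  𝕆                                ∎
  where
  open SetoidReasoning (≋-setoid m)
  regroup : ∀ G E H → G ⊗ E ⊗ H ⊗ (G ⊗ E ⊗ H) ≡ G ⊗ E ⊗ (H ⊗ G) ⊗ (E ⊗ H)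
  regroup = solve 3 (λ G E H → ((G ⊙ E) ⊙ H) ⊙ ((G ⊙ E) ⊙ H) ⊜ ((G ⊙ E) ⊙ (H ⊙ G)) ⊙ (E ⊙ H)) refl
  collapse : ∀ G E H → G ⊗ E ⊗ 𝕀 ⊗ (E ⊗ H) ≡ G ⊗ (E ⊗ E) ⊗ H
  collapse = solve 3 (λ G E H → ((G ⊙ E) ⊙ id) ⊙ (E ⊙ H) ⊜ (G ⊙ (E ⊙ E)) ⊙ H) refl

rescaled : ℤMat → ℤMat → ℤMat
rescaled G H = G ⊗ [ detℤ H , 0ℤ ∣ 0ℤ , 1ℤ ]

det-rescaled : ∀ {m} G H → detℤ G * detℤ H ≡ 1ℤ mod m → detℤ (rescaled G H) ≡ 1ℤ mod m
det-rescaled G H det≡1 = mod-trans (≡⇒mod (trans (det-⊗ G D) (cong (_*_ (detℤ G)) detD≡))) det≡1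
  where
  D : ℤMat
  D = [ detℤ H , 0ℤ ∣ 0ℤ , 1ℤ ]
  detD≡ : detℤ D ≡ detℤ H
  detD≡ = trans (ℤ.+-identityʳ (detℤ H * 1ℤ)) (ℤ.*-identityʳ (detℤ H))

-- For H = G⁻¹, W = G · diag(det H, 1) has determinant 1 and W⁻¹ (G E₁₂ H) W = det G · E₁₂.
conj-rescaled : ∀ {m} G H → H ⊗ G ≋ 𝕀 mod m → detℤ G * detℤ H ≡ 1ℤ mod m →
  let W = rescaled G H in detℤ H • (adjℤ W ⊗ (G ⊗ E₁₂ ⊗ H) ⊗ W) ≋ E₁₂ mod m
conj-rescaled {m} G H HG≋𝕀 det≡1 = begin
  ν • (adjℤ (G ⊗ D) ⊗ (G ⊗ E₁₂ ⊗ H) ⊗ (G ⊗ D))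
    ≡⟨ cong (λ P → ν • (P ⊗ (G ⊗ E₁₂ ⊗ H) ⊗ (G ⊗ D))) (adj-anti-⊗ G D) ⟩
  ν • (adjℤ D ⊗ adjℤ G ⊗ (G ⊗ E₁₂ ⊗ H) ⊗ (G ⊗ D))
    ≡⟨ cong (ν •_) (regroup (adjℤ D) (adjℤ G) G E₁₂ H D) ⟩
  ν • (adjℤ D ⊗ (adjℤ G ⊗ G ⊗ E₁₂ ⊗ (H ⊗ G)) ⊗ D)
    ≈⟨ •-cong mod-refl (⊗-cong (⊗-cong ≋-refl (⊗-cong (≡⇒≋ (cong (_⊗ E₁₂) (adj-inverseˡ G))) HG≋𝕀)) ≋-refl) ⟩
  ν • (adjℤ D ⊗ (μ • 𝕀 ⊗ E₁₂ ⊗ 𝕀) ⊗ D)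
    ≡⟨ cong (λ M → ν • (adjℤ D ⊗ M ⊗ D)) (trans (⊗-identityʳ (μ • 𝕀 ⊗ E₁₂)) (⊗-•ˡ μ 𝕀 E₁₂)) ⟩
  ν • (adjℤ D ⊗ μ • E₁₂ ⊗ D)
    ≡⟨ cong (ν •_) (trans (cong (_⊗ D) (⊗-•ʳ μ (adjℤ D) E₁₂)) (⊗-•ˡ μ (adjℤ D ⊗ E₁₂) D)) ⟩
  ν • μ • (adjℤ D ⊗ E₁₂ ⊗ D)
    ≡⟨ cong (λ M → ν • μ • M) (⊗-E₁₂-⊗ (adjℤ D) D) ⟩
  ν • μ • E₁₂
    ≡⟨ •-assoc ν μ E₁₂ ⟨
  (ν * μ) • E₁₂
    ≈⟨ •-cong (mod-trans (≡⇒mod (ℤ.*-comm ν μ)) det≡1) ≋-refl ⟩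
  1ℤ • E₁₂ ∎
  where
  open SetoidReasoning (≋-setoid m)
  μ ν : ℤ
  μ = detℤ G
  ν = detℤ H
  D : ℤMat
  D = [ ν , 0ℤ ∣ 0ℤ , 1ℤ ]
  regroup : ∀ A B G E H D → A ⊗ B ⊗ (G ⊗ E ⊗ H) ⊗ (G ⊗ D) ≡ A ⊗ (B ⊗ G ⊗ E ⊗ (H ⊗ G)) ⊗ D
  regroup = solve 6 (λ A B G E H D →
    ((A ⊙ B) ⊙ ((G ⊙ E) ⊙ H)) ⊙ (G ⊙ D) ⊜ (A ⊙ (((B ⊙ G) ⊙ E) ⊙ (H ⊙ G))) ⊙ D) refl

-- Residues and their integer representatives

module Residue (m : ℕ) .{{_ : NonZero m}} where

  ι : Fin m → ℤ
  ι x = + toℕ x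

  ι-mod : ∀ k → ι (k DivMod.mod m) ≡ + k mod + m
  ι-mod k rewrite toℕ-fromℕ< (DivMod.m%n<n k m) = mod-sym (by (+ k ℤ./ℕ m) (a≡a%ℕn+[a/ℕn]*n (+ k) m))

  reduce : ℤ → Fin m
  reduce z = (z ℤ.%ℕ m) DivMod.mod m

  ι-reduce : ∀ z → ι (reduce z) ≡ z mod + m
  ι-reduce z = mod-trans (ι-mod (z ℤ.%ℕ m)) (mod-sym (by (z ℤ./ℕ m) (a≡a%ℕn+[a/ℕn]*n z m)))

  ι-+ : ∀ x y → ι (_+ₘ_ m x y) ≡ ι x + ι y mod + m
  ι-+ x y = mod-trans (ι-mod (toℕ x ℕ.+ toℕ y)) (≡⇒mod (ℤ.pos-+ (toℕ x) (toℕ y)))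

  ι-* : ∀ x y → ι (_*ₘ_ m x y) ≡ ι x * ι y mod + m
  ι-* x y = mod-trans (ι-mod (toℕ x ℕ.* toℕ y)) (≡⇒mod (ℤ.pos-* (toℕ x) (toℕ y)))

  ι-neg : ∀ x → ι (-ₘ_ m x) ≡ - ι x mod + m
  ι-neg x = mod-trans (ι-mod (m ℕ.∸ toℕ x)) (by 1ℤ (begin
    + (m ℕ.∸ toℕ x)      ≡⟨ ℤ.⊖-≥ (ℕ.<⇒≤ (toℕ<n x)) ⟨
    m ℤ.⊖ toℕ x          ≡⟨ ℤ.m-n≡m⊖n m (toℕ x) ⟨
    + m - ι x            ≡⟨ identity (+ m) (ι x) ⟩
    - ι x + 1ℤ * + m     ∎))
    where
    open ≡-Reasoning
    identity : ∀ a b → a - b ≡ - b + 1ℤ * a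
    identity = solve-∀

  ι-0 : ι (0ₘ m) ≡ 0ℤ mod + m
  ι-0 = ι-mod 0

  ι-1 : ι (1ₘ m) ≡ 1ℤ mod + m
  ι-1 = ι-mod 1

  private
    no-positive-multiple : ∀ {x y} j → ι x ≢ ι y + +[1+ j ] * + m
    no-positive-multiple {x} {y} j eq = ℕ.<⇒≱ (toℕ<n x) (begin
      m                          ≤⟨ ℕ.m≤m+n m (j ℕ.* m) ⟩
      suc j ℕ.* m                ≤⟨ ℕ.m≤n+m (suc j ℕ.* m) (toℕ y) ⟩
      toℕ y ℕ.+ suc j ℕ.* m      ≡⟨ ℤ.+-injective (trans eq (sym representative)) ⟨
      toℕ x                      ∎)
      where
      open ℕ.≤-Reasoning
      representative : + (toℕ y ℕ.+ suc j ℕ.* m) ≡ ι y + +[1+ j ] * + m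
      representative = trans (ℤ.pos-+ (toℕ y) (suc j ℕ.* m)) (cong (_+_ (ι y)) (ℤ.pos-* (suc j) m))

  ι-injective : ∀ {x y} → ι x ≡ ι y mod + m → x ≡ y
  ι-injective {y = y} (by (+ zero) eq) = toℕ-injective (ℤ.+-injective (trans eq (ℤ.+-identityʳ (ι y))))
  ι-injective (by +[1+ j ] eq)          = ⊥-elim (no-positive-multiple j eq)
  ι-injective c@(by -[1+ j ] _)         = ⊥-elim (no-positive-multiple j (equation (mod-sym c)))

module ResidueMatrix (m : ℕ) .{{_ : NonZero m}} where
  open Residue m public

  infixl 7 _∙_
  _∙_ : Mat m → Mat m → Mat m
  _∙_ = _·_ m

  _^_ : Mat m → ℕ → Mat m
  x ^ zero  = I m
  x ^ suc k = x ∙ x ^ k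

  reduceMat : ℤMat → Mat m
  reduceMat [ a , b ∣ c , d ] = mat (reduce a) (reduce b) (reduce c) (reduce d)

  -- Opaque for the same reason as ℤMat is a data type.
  opaque
    ⟦_⟧ : Mat m → ℤMat
    ⟦ mat a b c d ⟧ = [ ι a , ι b ∣ ι c , ι d ]

    ⟦∙⟧ : ∀ x y → ⟦ x ∙ y ⟧ ≋ ⟦ x ⟧ ⊗ ⟦ y ⟧ mod + m
    ⟦∙⟧ (mat a b c d) (mat p q r s) = entries (entry a p b r) (entry a q b s) (entry c p d r) (entry c q d s)
      where
      entry : ∀ w x y z → ι (_+ₘ_ m (_*ₘ_ m w x) (_*ₘ_ m y z)) ≡ ι w * ι x + ι y * ι z mod + m
      entry w x y z = mod-trans (ι-+ (_*ₘ_ m w x) (_*ₘ_ m y z)) (+-cong-mod (ι-* w x) (ι-* y z))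

    ⟦det⟧ : ∀ x → ι (det m x) ≡ detℤ ⟦ x ⟧ mod + m
    ⟦det⟧ (mat a b c d) =
      mod-trans (ι-+ (_*ₘ_ m a d) (-ₘ_ m (_*ₘ_ m b c)))
                (+-cong-mod (ι-* a d) (mod-trans (ι-neg (_*ₘ_ m b c)) (neg-cong-mod (ι-* b c))))

    ⟦adj⟧ : ∀ x → ⟦ adj m x ⟧ ≋ adjℤ ⟦ x ⟧ mod + m
    ⟦adj⟧ (mat a b c d) = entries mod-refl (ι-neg b) (ι-neg c) mod-refl

    ⟦I⟧ : ⟦ I m ⟧ ≋ 𝕀 mod + m
    ⟦I⟧ = entries ι-1 ι-0 ι-0 ι-1

    ⟦u⟧ : ⟦ u m ⟧ ≋ 𝕀 ⊕ E₁₂ mod + m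
    ⟦u⟧ = entries ι-1 ι-1 ι-0 ι-1

    ⟦⟧-injective : ∀ {x y} → ⟦ x ⟧ ≋ ⟦ y ⟧ mod + m → x ≡ y
    ⟦⟧-injective {mat _ _ _ _} {mat _ _ _ _} (entries e₁₁ e₁₂ e₂₁ e₂₂)
      rewrite ι-injective e₁₁ | ι-injective e₁₂ | ι-injective e₂₁ | ι-injective e₂₂ = refl

    ⟦reduceMat⟧ : ∀ W → ⟦ reduceMat W ⟧ ≋ W mod + m
    ⟦reduceMat⟧ [ a , b ∣ c , d ] = entries (ι-reduce a) (ι-reduce b) (ι-reduce c) (ι-reduce d)

  det-SL : ∀ x → IsSL m x → detℤ ⟦ x ⟧ ≡ 1ℤ mod + m
  det-SL x det≡1 = mod-trans (mod-sym (⟦det⟧ x)) (subst (λ d → ι d ≡ 1ℤ mod + m) (sym det≡1) ι-1)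

  SL-det : ∀ x → detℤ ⟦ x ⟧ ≡ 1ℤ mod + m → IsSL m x
  SL-det x det≡1 = ι-injective (mod-trans (⟦det⟧ x) (mod-trans det≡1 (mod-sym ι-1)))

  ⟦^⟧ : ∀ x V → ⟦ x ⟧ ≋ 𝕀 ⊕ V mod + m → V ⊗ V ≋ 𝕆 mod + m → ∀ k → ⟦ x ^ k ⟧ ≋ 𝕀 ⊕ (+ k) • V mod + m
  ⟦^⟧ x V x≋𝕀⊕V V²≋𝕆 zero = begin
    ⟦ I m ⟧           ≈⟨ ⟦I⟧ ⟩
    𝕀                 ≡⟨ ⊕-identityʳ 𝕀 ⟨
    𝕀 ⊕ 𝕆             ≡⟨ cong (_⊕_ 𝕀) (•-zeroˡ V) ⟨
    𝕀 ⊕ (+ 0) • V       ∎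
    where open SetoidReasoning (≋-setoid (+ m))
  ⟦^⟧ x V x≋𝕀⊕V V²≋𝕆 (suc k) = begin
    ⟦ x ∙ x ^ k ⟧                         ≈⟨ ⟦∙⟧ x (x ^ k) ⟩
    ⟦ x ⟧ ⊗ ⟦ x ^ k ⟧                      ≈⟨ ⊗-cong x≋𝕀⊕V (⟦^⟧ x V x≋𝕀⊕V V²≋𝕆 k) ⟩
    (𝕀 ⊕ V) ⊗ (𝕀 ⊕ (+ k) • V)               ≡⟨ 𝕀⊕-⊗-𝕀⊕ V ((+ k) • V) ⟩
    𝕀 ⊕ (V ⊕ (+ k) • V) ⊕ V ⊗ (+ k) • V       ≡⟨ cong₂ (λ P Q → 𝕀 ⊕ P ⊕ Q) (sym (•-suc (+ k) V)) (⊗-•ʳ (+ k) V V) ⟩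
    𝕀 ⊕ +[1+ k ] • V ⊕ (+ k) • (V ⊗ V)       ≈⟨ ⊕-cong ≋-refl (•-cong mod-refl V²≋𝕆) ⟩
    𝕀 ⊕ +[1+ k ] • V ⊕ (+ k) • 𝕆             ≡⟨ cong (_⊕_ (𝕀 ⊕ +[1+ k ] • V)) (•-zeroʳ (+ k)) ⟩
    𝕀 ⊕ +[1+ k ] • V ⊕ 𝕆                   ≡⟨ ⊕-identityʳ (𝕀 ⊕ +[1+ k ] • V) ⟩
    𝕀 ⊕ +[1+ k ] • V                       ∎
    where open SetoidReasoning (≋-setoid (+ m))

-- The congruence kernel of A

module CongruenceKernel (N : ℕ) .{{_ : NonZero N}} .{{_ : NonZero (N ℕ.* N)}}
  (A : Mat (N ℕ.* N) → Set) (A-subgroup : IsSubgroupSL (N ℕ.* N) A) (A-surjective : ReductionSurjSL N A) where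

  open IsSubgroupSL A-subgroup
  open ResidueMatrix (N ℕ.* N)
  private
    module ModN = ResidueMatrix N

  n N² : ℤ
  n = + N
  N² = + (N ℕ.* N)

  N²≡n*n : N² ≡ n * n
  N²≡n*n = ℤ.pos-* N N

  mod-N²⇒n : ∀ {x y} → x ≡ y mod N² → x ≡ y mod n
  mod-N²⇒n {x} {y} x≡y = mod-weaken n (subst (λ k → x ≡ y mod k) N²≡n*n x≡y)

  ≋-N²⇒n : ∀ {X Y} → X ≋ Y mod N² → X ≋ Y mod n
  ≋-N²⇒n {X} {Y} X≋Y = ≋-weaken n (subst (λ k → X ≋ Y mod k) N²≡n*n X≋Y)

  ≋-n*n⇒N² : ∀ {X Y} → X ≋ Y mod n * n → X ≋ Y mod N²
  ≋-n*n⇒N² {X} {Y} = subst (λ k → X ≋ Y mod k) (sym N²≡n*n)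

  -- Modulo N, these Y form the Lie algebra of the kernel of the reduction A → SL₂(ℤ/N).
  Lie : ℤMat → Set
  Lie Y = Σ (Mat (N ℕ.* N)) λ y → A y × ⟦ y ⟧ ≋ 𝕀 ⊕ n • Y mod N²

  Lie-resp : ∀ {Y Z} → Y ≋ Z mod n → Lie Y → Lie Z
  Lie-resp Y≋Z (y , y∈A , y≋) = y , y∈A , ≋-trans y≋ (≋-n*n⇒N² (⊕-cong ≋-refl (≋-scale n Y≋Z)))

  Lie-𝕆 : Lie 𝕆
  Lie-𝕆 = I (N ℕ.* N) , has-I , ≋-trans ⟦I⟧ (≡⇒≋ (sym (trans (cong (_⊕_ 𝕀) (•-zeroʳ n)) (⊕-identityʳ 𝕀))))

  Lie-⊕ : ∀ {Y Z} → Lie Y → Lie Z → Lie (Y ⊕ Z)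
  Lie-⊕ {Y} {Z} (y , y∈A , y≋) (z , z∈A , z≋) = y ∙ z , ·-closed y z y∈A z∈A , (begin
    ⟦ y ∙ z ⟧                                   ≈⟨ ⟦∙⟧ y z ⟩
    ⟦ y ⟧ ⊗ ⟦ z ⟧                                ≈⟨ ⊗-cong y≋ z≋ ⟩
    (𝕀 ⊕ n • Y) ⊗ (𝕀 ⊕ n • Z)                   ≡⟨ 𝕀⊕-⊗-𝕀⊕ (n • Y) (n • Z) ⟩
    𝕀 ⊕ (n • Y ⊕ n • Z) ⊕ n • Y ⊗ n • Z         ≡⟨ cong₂ (λ P Q → 𝕀 ⊕ P ⊕ Q) (sym (•-distribˡ-⊕ n Y Z)) (•-⊗-• n n Y Z) ⟩
    𝕀 ⊕ n • (Y ⊕ Z) ⊕ (n * n) • (Y ⊗ Z)         ≈⟨ ≋-n*n⇒N² (⊕-multiple (n * n) (𝕀 ⊕ n • (Y ⊕ Z)) (Y ⊗ Z)) ⟩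
    𝕀 ⊕ n • (Y ⊕ Z)                             ∎)
    where open SetoidReasoning (≋-setoid N²)

  Lie-•ℕ : ∀ {Y} k → Lie Y → Lie ((+ k) • Y)
  Lie-•ℕ {Y} zero    _ = subst Lie (sym (•-zeroˡ Y)) Lie-𝕆
  Lie-•ℕ {Y} (suc k) L = subst Lie (sym (•-suc (+ k) Y)) (Lie-⊕ L (Lie-•ℕ k L))

  Lie-• : ∀ {Y} c → Lie Y → Lie (c • Y)
  Lie-• c L = Lie-resp (•-cong c%N≡c ≋-refl) (Lie-•ℕ (c ℤ.%ℕ N) L)
    where
    c%N≡c : + (c ℤ.%ℕ N) ≡ c mod n
    c%N≡c = mod-sym (by (c ℤ./ℕ N) (a≡a%ℕn+[a/ℕn]*n c N))

  Lie-conj : ∀ {Y a} → A a → Lie Y → Lie (adjℤ ⟦ a ⟧ ⊗ Y ⊗ ⟦ a ⟧)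
  Lie-conj {Y} {a} a∈A (y , y∈A , y≋) =
    adj (N ℕ.* N) a ∙ y ∙ a , ·-closed _ a (·-closed _ y (inv-closed a a∈A) y∈A) a∈A , (begin
      ⟦ adj (N ℕ.* N) a ∙ y ∙ a ⟧                ≈⟨ ⟦∙⟧ (adj (N ℕ.* N) a ∙ y) a ⟩
      ⟦ adj (N ℕ.* N) a ∙ y ⟧ ⊗ ⟦ a ⟧            ≈⟨ ⊗-cong (⟦∙⟧ (adj (N ℕ.* N) a) y) ≋-refl ⟩
      ⟦ adj (N ℕ.* N) a ⟧ ⊗ ⟦ y ⟧ ⊗ ⟦ a ⟧        ≈⟨ ⊗-cong (⊗-cong (⟦adj⟧ a) y≋) ≋-refl ⟩
      ā ⊗ (𝕀 ⊕ n • Y) ⊗ ⟦ a ⟧                   ≡⟨ ⊗-𝕀⊕-⊗ ā (n • Y) ⟦ a ⟧ ⟩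
      ā ⊗ ⟦ a ⟧ ⊕ ā ⊗ n • Y ⊗ ⟦ a ⟧            ≡⟨ cong₂ _⊕_ (adj-inverseˡ ⟦ a ⟧)
                                                     (trans (cong (_⊗ ⟦ a ⟧) (⊗-•ʳ n ā Y)) (⊗-•ˡ n (ā ⊗ Y) ⟦ a ⟧)) ⟩
      detℤ ⟦ a ⟧ • 𝕀 ⊕ n • (ā ⊗ Y ⊗ ⟦ a ⟧)      ≈⟨ ⊕-cong (•-cong (det-SL a (⊆SL a a∈A)) ≋-refl) ≋-refl ⟩
      𝕀 ⊕ n • (ā ⊗ Y ⊗ ⟦ a ⟧)                   ∎)
    where
    open SetoidReasoning (≋-setoid N²)
    ā : ℤMat
    ā = adjℤ ⟦ a ⟧

  opaque
    unfolding ⟦_⟧ ModN.⟦_⟧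
    ⟦red⟧ : ∀ x → ModN.⟦ red N x ⟧ ≋ ⟦ x ⟧ mod n
    ⟦red⟧ (mat a b c d) = entries (ModN.ι-mod (toℕ a)) (ModN.ι-mod (toℕ b)) (ModN.ι-mod (toℕ c)) (ModN.ι-mod (toℕ d))

  lift : ∀ W → detℤ W ≡ 1ℤ mod n → Σ (Mat (N ℕ.* N)) λ a → A a × ⟦ a ⟧ ≋ W mod n
  lift W detW≡1
    with A-surjective (ModN.reduceMat W) (ModN.SL-det (ModN.reduceMat W) (mod-trans (det-cong (ModN.⟦reduceMat⟧ W)) detW≡1))
  ... | a , a∈A , red≡ =
    a , a∈A , ≋-trans (≋-sym (⟦red⟧ a)) (subst (λ y → ModN.⟦ y ⟧ ≋ W mod n) (sym red≡) (ModN.⟦reduceMat⟧ W))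

  Lie-conj-SL : ∀ {Y} W → detℤ W ≡ 1ℤ mod n → Lie Y → Lie (adjℤ W ⊗ Y ⊗ W)
  Lie-conj-SL {Y} W detW≡1 L = conj (lift W detW≡1)
    where
    conj : Σ (Mat (N ℕ.* N)) (λ a → A a × ⟦ a ⟧ ≋ W mod n) → Lie (adjℤ W ⊗ Y ⊗ W)
    conj (a , a∈A , a≋W) = Lie-resp (⊗-cong (⊗-cong (adj-cong a≋W) ≋-refl) a≋W) (Lie-conj a∈A L)

  Lie-traceless : Lie E₁₂ → ∀ X → trℤ X ≡ 0ℤ mod n → Lie X
  Lie-traceless L-E₁₂ [ t , q ∣ r , s ] t+s≡0 =
    Lie-resp decomposition (Lie-⊕ (Lie-⊕ (Lie-• t L-H) (Lie-• (q + t) L-E₁₂)) (Lie-• (r - t) L-E₂₁))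
    where
    L-E₂₁ : Lie E₂₁
    L-E₂₁ = Lie-conj-SL [ 0ℤ , - 1ℤ ∣ 1ℤ , 0ℤ ] mod-refl (Lie-• (- 1ℤ) L-E₁₂)
    L-H : Lie [ 1ℤ , - 1ℤ ∣ 1ℤ , - 1ℤ ]
    L-H = Lie-conj-SL [ 1ℤ , - 1ℤ ∣ 0ℤ , 1ℤ ] mod-refl L-E₂₁
    s≡-t : s ≡ - t mod n
    s≡-t = mod-trans (≡⇒mod (shift t s))
             (mod-trans (+-cong-mod (mod-refl {x = - t}) t+s≡0) (≡⇒mod (ℤ.+-identityʳ (- t))))
      where
      shift : ∀ t s → s ≡ - t + (t + s)
      shift = solve-∀
    decomposition : t • [ 1ℤ , - 1ℤ ∣ 1ℤ , - 1ℤ ] ⊕ (q + t) • E₁₂ ⊕ (r - t) • E₂₁ ≋ [ t , q ∣ r , s ] mod n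
    decomposition = entries (≡⇒mod (e₁₁ t q r)) (≡⇒mod (e₁₂ t q r)) (≡⇒mod (e₂₁ t q r))
                            (mod-trans (≡⇒mod (e₂₂ t q r)) (mod-sym s≡-t))
      where
      e₁₁ : ∀ t q r → t * 1ℤ + (q + t) * 0ℤ + (r - t) * 0ℤ ≡ t
      e₁₁ = solve-∀
      e₁₂ : ∀ t q r → t * - 1ℤ + (q + t) * 1ℤ + (r - t) * 0ℤ ≡ q
      e₁₂ = solve-∀
      e₂₁ : ∀ t q r → t * 1ℤ + (q + t) * 0ℤ + (r - t) * 1ℤ ≡ r
      e₂₁ = solve-∀
      e₂₂ : ∀ t q r → t * - 1ℤ + (q + t) * 0ℤ + (r - t) * 0ℤ ≡ - t
      e₂₂ = solve-∀

  -- z a⁻¹ ≡ 𝕀 modulo N, so z a⁻¹ = 𝕀 + N X, and det (z a⁻¹) ≡ 1 modulo N² forces tr X ≡ 0 modulo N.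
  congruent⇒∈A : (∀ X → trℤ X ≡ 0ℤ mod n → Lie X) →
                 ∀ {a} z → A a → IsSL (N ℕ.* N) z → ⟦ a ⟧ ≋ ⟦ z ⟧ mod n → A z
  congruent⇒∈A traceless⊆Lie {a} z a∈A z∈SL a≋z = subst A (⟦⟧-injective ya≋z) (·-closed y a y∈A a∈A)
    where
    K : ℤMat
    K = ⟦ z ⟧ ⊗ adjℤ ⟦ a ⟧
    det-a≡1 : detℤ ⟦ a ⟧ ≡ 1ℤ mod N²
    det-a≡1 = det-SL a (⊆SL a a∈A)
    K≋𝕀 : K ≋ 𝕀 mod n
    K≋𝕀 = begin
      ⟦ z ⟧ ⊗ adjℤ ⟦ a ⟧     ≈⟨ ⊗-cong (≋-sym a≋z) ≋-refl ⟩
      ⟦ a ⟧ ⊗ adjℤ ⟦ a ⟧     ≡⟨ adj-inverseʳ ⟦ a ⟧ ⟩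
      detℤ ⟦ a ⟧ • 𝕀         ≈⟨ •-cong (mod-N²⇒n det-a≡1) ≋-refl ⟩
      𝕀                      ∎
      where open SetoidReasoning (≋-setoid n)
    X : ℤMat
    X = proj₁ (≋𝕀⇒𝕀⊕ K≋𝕀)
    K≡𝕀⊕nX : K ≡ 𝕀 ⊕ n • X
    K≡𝕀⊕nX = proj₂ (≋𝕀⇒𝕀⊕ K≋𝕀)
    detK≡1 : detℤ K ≡ 1ℤ mod N²
    detK≡1 = begin
      detℤ K                              ≡⟨ det-⊗ ⟦ z ⟧ (adjℤ ⟦ a ⟧) ⟩
      detℤ ⟦ z ⟧ * detℤ (adjℤ ⟦ a ⟧)       ≡⟨ cong (_*_ (detℤ ⟦ z ⟧)) (det-adj ⟦ a ⟧) ⟩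
      detℤ ⟦ z ⟧ * detℤ ⟦ a ⟧              ≈⟨ *-cong-mod (det-SL z z∈SL) det-a≡1 ⟩
      1ℤ                                  ∎
      where open SetoidReasoning (mod-setoid N²)
    trX≡0 : trℤ X ≡ 0ℤ mod n
    trX≡0 = trace-vanishes n X (subst₂ (λ M k → detℤ M ≡ 1ℤ mod k) K≡𝕀⊕nX N²≡n*n detK≡1)
    y : Mat (N ℕ.* N)
    y = proj₁ (traceless⊆Lie X trX≡0)
    y∈A : A y
    y∈A = proj₁ (proj₂ (traceless⊆Lie X trX≡0))
    ya≋z : ⟦ y ∙ a ⟧ ≋ ⟦ z ⟧ mod N²
    ya≋z = begin
      ⟦ y ∙ a ⟧                    ≈⟨ ⟦∙⟧ y a ⟩
      ⟦ y ⟧ ⊗ ⟦ a ⟧                 ≈⟨ ⊗-cong (proj₂ (proj₂ (traceless⊆Lie X trX≡0))) ≋-refl ⟩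
      (𝕀 ⊕ n • X) ⊗ ⟦ a ⟧           ≡⟨ cong (_⊗ ⟦ a ⟧) K≡𝕀⊕nX ⟨
      ⟦ z ⟧ ⊗ adjℤ ⟦ a ⟧ ⊗ ⟦ a ⟧     ≡⟨ ⊗-adj-⊗ ⟦ z ⟧ ⟦ a ⟧ ⟩
      detℤ ⟦ a ⟧ • ⟦ z ⟧            ≈⟨ •-cong det-a≡1 ≋-refl ⟩
      1ℤ • ⟦ z ⟧                    ≡⟨ •-identityˡ ⟦ z ⟧ ⟩
      ⟦ z ⟧                         ∎
      where open SetoidReasoning (≋-setoid N²)

  A-complete : Lie E₁₂ → ∀ z → IsSL (N ℕ.* N) z → A z
  A-complete L-E₁₂ z z∈SL = complete (lift ⟦ z ⟧ (mod-N²⇒n (det-SL z z∈SL)))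
    where
    complete : Σ (Mat (N ℕ.* N)) (λ a → A a × ⟦ a ⟧ ≋ ⟦ z ⟧ mod n) → A z
    complete (a , a∈A , a≋z) = congruent⇒∈A (Lie-traceless L-E₁₂) z a∈A z∈SL a≋z

  ^-closed : ∀ {x} → A x → ∀ k → A (x ^ k)
  ^-closed x∈A zero    = has-I
  ^-closed x∈A (suc k) = ·-closed _ _ x∈A (^-closed x∈A k)

  unipotent⇒Lie-E₁₂ : ∀ x g h → A x → g ∙ h ≡ I (N ℕ.* N) → h ∙ g ≡ I (N ℕ.* N) →
                      x ≡ g ∙ u (N ℕ.* N) ∙ h → Lie E₁₂
  unipotent⇒Lie-E₁₂ x g h x∈A gh≡I hg≡I x≡guh = Lie-resp (conj-rescaled G H (≋-N²⇒n HG≋𝕀) detGH≡1)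
    (Lie-• (detℤ H) (Lie-conj-SL (rescaled G H) (det-rescaled G H detGH≡1) L-V))
    where
    G H V : ℤMat
    G = ⟦ g ⟧
    H = ⟦ h ⟧
    V = G ⊗ E₁₂ ⊗ H
    inverse : ∀ p q → p ∙ q ≡ I (N ℕ.* N) → ⟦ p ⟧ ⊗ ⟦ q ⟧ ≋ 𝕀 mod N²
    inverse p q pq≡I = ≋-trans (≋-sym (⟦∙⟧ p q)) (subst (λ w → ⟦ w ⟧ ≋ 𝕀 mod N²) (sym pq≡I) ⟦I⟧)
    GH≋𝕀 : G ⊗ H ≋ 𝕀 mod N²
    GH≋𝕀 = inverse g h gh≡I
    HG≋𝕀 : H ⊗ G ≋ 𝕀 mod N²
    HG≋𝕀 = inverse h g hg≡I
    detGH≡1 : detℤ G * detℤ H ≡ 1ℤ mod n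
    detGH≡1 = mod-N²⇒n (det-inverse G H GH≋𝕀)
    x≋𝕀⊕V : ⟦ x ⟧ ≋ 𝕀 ⊕ V mod N²
    x≋𝕀⊕V = begin
      ⟦ x ⟧                        ≡⟨ cong ⟦_⟧ x≡guh ⟩
      ⟦ g ∙ u (N ℕ.* N) ∙ h ⟧       ≈⟨ ⟦∙⟧ (g ∙ u (N ℕ.* N)) h ⟩
      ⟦ g ∙ u (N ℕ.* N) ⟧ ⊗ H       ≈⟨ ⊗-cong (⟦∙⟧ g (u (N ℕ.* N))) ≋-refl ⟩
      G ⊗ ⟦ u (N ℕ.* N) ⟧ ⊗ H       ≈⟨ ⊗-cong (⊗-cong ≋-refl ⟦u⟧) ≋-refl ⟩
      G ⊗ (𝕀 ⊕ E₁₂) ⊗ H            ≡⟨ ⊗-𝕀⊕-⊗ G E₁₂ H ⟩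
      G ⊗ H ⊕ V                    ≈⟨ ⊕-cong GH≋𝕀 ≋-refl ⟩
      𝕀 ⊕ V                        ∎
      where open SetoidReasoning (≋-setoid N²)
    L-V : Lie V
    L-V = x ^ N , ^-closed x∈A N , ⟦^⟧ x V x≋𝕀⊕V (unipotent-square G H HG≋𝕀) N

-- The argument works for every N ≥ 1.
lemma4p4 : (N : ℕ) .{{_ : NonZero N}} .{{_ : NonZero (N ℕ.* N)}} → 2 ≤ N → (A : Mat (N ℕ.* N) → Set) → IsSubgroupSL (N ℕ.* N) A → ProperSL (N ℕ.* N) A → ReductionSurjSL N A → (x : Mat (N ℕ.* N)) → A x → ¬ GLConj (N ℕ.* N) x (u (N ℕ.* N))
lemma4p4 N _ A A-subgroup (z , z∈SL , z∉A) A-surjective x x∈A (g , h , gh≡I , hg≡I , x≡guh) =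
  z∉A (A-complete (unipotent⇒Lie-E₁₂ x g h x∈A gh≡I hg≡I x≡guh) z z∈SL)
  where open CongruenceKernel N A A-subgroup A-surjective
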